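{- There is a constant $c\in\mathbb{N}$ such that there are arbitrarily large $n\in\mathbb{N}$ satisfying \[ \mathrm{LS}(\mathrm{FO}[n])\ge \mathrm{twr}\bigl(\sqrt[3]{n/c}\bigr). \]
   Context: Words are nonempty finite words over $\Sigma=\{l,r\}$, identified with word models (positions with linear order $<$ and unary predicates $P_l,P_r$). FO formulas are over $\{<,P_l,P_r\}$. Size: $\mathrm{sz}(\phi)=1$ for atomic $\phi$; $\mathrm{sz}(\psi\wedge\theta)=\mathrm{sz}(\psi\vee\theta)=\mathrm{sz}(\psi)+\mathrm{sz}(\theta)+1$; $\mathrm{sz}(\neg\psi)=\mathrm{sz}(\exists x\psi)=\mathrm{sz}(\forall x\psi)=\mathrm{sz}(\psi)+1$. $\mathrm{FO}[n]$ is the set of FO formulas of size at most $n$. For a sentence $\phi$, $\mu(\phi)$ is the minimal length of a word satisfying $\phi$ ($\mu(\phi)=0$ if $\phi$ has no models). The Löwenheim–Skolem number is $\mathrm{LS}(L)=\max\{\mu(\phi):\phi\in L\}$. $\mathrm{tower}(0)=1$, $\mathrm{tower}(n+1)=2^{\mathrm{tower}(n)}$; for real $x\ge0$, $\mathrm{twr}(x)=\mathrm{tower}(\lceil x\rceil)$. -}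

module Defs where

open import Data.Nat using (ℕ; zero; suc; _+_; _*_; _^_; _≤_; _<_)
open import Data.Fin using (Fin; toℕ)
open import Data.List.NonEmpty using (List⁺; length; toList)
open import Data.List using (lookup)
open import Data.Product using (Σ; ∃; _×_; _,_)
open import Data.Sum using (_⊎_)
open import Data.Empty using (⊥)
open import Relation.Nullary using (¬_)
open import Relation.Binary.PropositionalEquality using (_≡_)

data Letter : Set where
  l r : Letter

Word : Set
Word = List⁺ Letter

Pos : Word → Set
Pos w = Fin (length w)

letterAt : (w : Word) → Pos w → Letter
letterAt w i = lookup (toList w) i

Var : Set
Var = ℕ

data Formula : Set where
  _≐_  : Var → Var → Formula
  _≺_  : Var → Var → Formula
  Pl   : Var → Formula
  Pr   : Var → Formula
  _∧ᶠ_ : Formula → Formula → Formula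
  _∨ᶠ_ : Formula → Formula → Formula
  ¬ᶠ_  : Formula → Formula
  ∃ᶠ   : Var → Formula → Formula
  ∀ᶠ   : Var → Formula → Formula

sz : Formula → ℕ
sz (x ≐ y)   = 1
sz (x ≺ y)   = 1
sz (Pl x)    = 1
sz (Pr x)    = 1
sz (φ ∧ᶠ ψ)  = sz φ + sz ψ + 1
sz (φ ∨ᶠ ψ)  = sz φ + sz ψ + 1
sz (¬ᶠ φ)    = sz φ + 1
sz (∃ᶠ x φ)  = sz φ + 1
sz (∀ᶠ x φ)  = sz φ + 1

FreeIn : Var → Formula → Set
FreeIn v (x ≐ y)  = (v ≡ x) ⊎ (v ≡ y)
FreeIn v (x ≺ y)  = (v ≡ x) ⊎ (v ≡ y)
FreeIn v (Pl x)   = v ≡ x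
FreeIn v (Pr x)   = v ≡ x
FreeIn v (φ ∧ᶠ ψ) = FreeIn v φ ⊎ FreeIn v ψ
FreeIn v (φ ∨ᶠ ψ) = FreeIn v φ ⊎ FreeIn v ψ
FreeIn v (¬ᶠ φ)   = FreeIn v φ
FreeIn v (∃ᶠ x φ) = ¬ (v ≡ x) × FreeIn v φ
FreeIn v (∀ᶠ x φ) = ¬ (v ≡ x) × FreeIn v φ

Sentence : Formula → Set
Sentence φ = ∀ v → ¬ FreeIn v φ

Assign : Word → Set
Assign w = Var → Pos w

update : (w : Word) → Assign w → Var → Pos w → Assign w
update w ρ x i v with v Data.Nat.≟ x
... | Relation.Nullary.yes _ = i
... | Relation.Nullary.no  _ = ρ v

Sat : (w : Word) → Assign w → Formula → Set
Sat w ρ (x ≐ y)  = ρ x ≡ ρ y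
Sat w ρ (x ≺ y)  = toℕ (ρ x) < toℕ (ρ y)
Sat w ρ (Pl x)   = letterAt w (ρ x) ≡ l
Sat w ρ (Pr x)   = letterAt w (ρ x) ≡ r
Sat w ρ (φ ∧ᶠ ψ) = Sat w ρ φ × Sat w ρ ψ
Sat w ρ (φ ∨ᶠ ψ) = Sat w ρ φ ⊎ Sat w ρ ψ
Sat w ρ (¬ᶠ φ)   = ¬ Sat w ρ φ
Sat w ρ (∃ᶠ x φ) = Σ (Pos w) λ i → Sat w (update w ρ x i) φ
Sat w ρ (∀ᶠ x φ) = (i : Pos w) → Sat w (update w ρ x i) φ

-- w ⊨ φ for a sentence φ (assignment irrelevant for sentences)
_⊨_ : Word → Formula → Set
w ⊨ φ = (ρ : Assign w) → Sat w ρ φ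

-- IsMu φ m  :  m = μ(φ), the minimal length of a model of φ (0 if none)
IsMu : Formula → ℕ → Set
IsMu φ m =
  ((∀ (w : Word) → ¬ (w ⊨ φ)) × m ≡ 0)
  ⊎ ((Σ Word λ w → (w ⊨ φ) × length w ≡ m)
     × (∀ (w : Word) → w ⊨ φ → m ≤ length w))

-- IsLS n L  :  L = LS(FO[n]) = max { μ(φ) : φ sentence, sz φ ≤ n }
IsLS : ℕ → ℕ → Set
IsLS n L =
  (Σ Formula λ φ → Sentence φ × sz φ ≤ n × IsMu φ L)
  × (∀ (φ : Formula) → Sentence φ → sz φ ≤ n → ∀ m → IsMu φ m → m ≤ L)

tower : ℕ → ℕ
tower zero    = 1
tower (suc k) = 2 ^ tower k

-- IsCeilCbrt n c k  :  k = ⌈ (n/c)^(1/3) ⌉, i.e. k is least with c·k³ ≥ n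
IsCeilCbrt : ℕ → ℕ → ℕ → Set
IsCeilCbrt n c k = (n ≤ c * k ^ 3) × (∀ j → j < k → c * j ^ 3 < n)

-- Positions of a word carry hereditarily finite sets: reading the word after a position, its level-(i + 1)
-- code is the set of the level-i codes of the level-i markers that follow it before the next marker of higher
-- level, so level-i codes range over Fin (tower i). Equality of level-i codes is first-order definable by
-- extensionality with formulas of size O(i²). The sentence towerF k states, for every level i < k, that
-- some position has no children and that the child set of any position can be toggled at any realised
-- code; level by level, every set of codes is then realised, so every model has at least tower k positions.
-- A model exists (list every code of level ≤ k once), and towerF k has size at most 409 k³, so
-- LS(FO[409 k³]) ≥ μ(towerF k) ≥ tower k.

module Submission where

open import Defs
open import Data.Bool using (Bool; true; false; _xor_; if_then_else_)
import Data.Bool.Properties as Bool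
open import Data.Fin as Fin using (Fin; toℕ; fromℕ<; combine)
open import Data.Fin.Properties
  using (_≟_; toℕ-fromℕ<; toℕ<n; ≤fromℕ; injective⇒≤; combine-injective; combine-surjective; any?; all?)
open import Data.List as List using (List; []; _∷_; _++_; drop; length; replicate; filter; allFin)
open import Data.List.Membership.Propositional using (_∈_)
open import Data.List.Membership.Propositional.Properties using (∈-filter⁺; ∈-filter⁻; ∈-allFin)
import Data.List.NonEmpty as List⁺
open import Data.List.Properties using (drop-[]; drop-drop; ++-assoc; ∷-injectiveˡ; ∷-injectiveʳ)
open import Data.List.Relation.Unary.All as All using (All)
open import Data.List.Relation.Unary.All.Properties using (++⁺)
open import Data.List.Relation.Unary.Any as Any using (here; there)
open import Data.Nat as ℕ using (ℕ; zero; suc; _+_; _*_; _^_; _≤_; _<_; z≤n; s≤s)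
import Data.Nat.Properties as ℕ
open import Data.Nat.Induction using (<-rec)
open import Data.Nat.Tactic.RingSolver using (solve)
open import Data.Product using (Σ; ∃; _×_; _,_; proj₁; proj₂)
open import Data.Product.Function.NonDependent.Propositional using (_×-⇔_)
open import Data.Sum using (_⊎_; inj₁; inj₂)
open import Data.Unit using (⊤)
open import Data.Vec as Vec using (Vec; lookup; tabulate)
open import Data.Vec.Properties using (tabulate-cong; tabulate∘lookup; lookup∘tabulate; lookup-replicate)
open import Function.Bundles using (_⇔_; mk⇔; module Equivalence)
open import Function.Properties.Equivalence using () renaming (refl to ⇔-refl; sym to ⇔-sym; trans to ⇔-trans)
open import Function.Related.TypeIsomorphisms using (→-cong-⇔)
open import Relation.Binary.PropositionalEquality
  using (_≡_; _≢_; refl; sym; trans; cong; cong₂; subst; subst₂; module ≡-Reasoning)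
open import Relation.Nullary using (Dec; yes; no; does; ¬_; contradiction)
open import Relation.Nullary.Decidable using (False; toWitnessFalse; dec-false; map′; _×-dec_; _⊎-dec_; ¬?)
open import Relation.Unary using (Decidable)

open Equivalence

bit : Bool → Fin 2
bit false = Fin.zero
bit true  = Fin.suc Fin.zero

bit-injective : ∀ {a b} → bit a ≡ bit b → a ≡ b
bit-injective {false} {false} _ = refl
bit-injective {true}  {true}  _ = refl

bit-surjective : ∀ q → ∃ λ b → bit b ≡ q
bit-surjective Fin.zero            = false , refl
bit-surjective (Fin.suc Fin.zero) = true , refl

fromBits : ∀ {t} → Vec Bool t → Fin (2 ^ t)
fromBits Vec.[]      = Fin.zero
fromBits (b Vec.∷ v) = combine (bit b) (fromBits v)

fromBits-injective : ∀ {t} {u v : Vec Bool t} → fromBits u ≡ fromBits v → u ≡ v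
fromBits-injective {u = Vec.[]} {Vec.[]} _ = refl
fromBits-injective {suc t} {a Vec.∷ u} {b Vec.∷ v} e
  with a≡b , u≡v ← combine-injective {2} {2 ^ t} (bit a) (fromBits u) (bit b) (fromBits v) e
  = cong₂ Vec._∷_ (bit-injective a≡b) (fromBits-injective {t} u≡v)

fromBits-surjective : ∀ {t} (m : Fin (2 ^ t)) → ∃ λ (v : Vec Bool t) → fromBits v ≡ m
fromBits-surjective {zero}  Fin.zero = Vec.[] , refl
fromBits-surjective {suc t} m
  with q , m′ , e ← combine-surjective {2} {2 ^ t} m
  with b , eb ← bit-surjective q | v , ev ← fromBits-surjective {t} m′
  = b Vec.∷ v , trans (cong₂ combine eb ev) e

toggle : ∀ {n} → Vec Bool n → Fin n → Vec Bool n
toggle v a = tabulate λ b → lookup v b xor does (b ≟ a)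

toggle-generates : ∀ {n} (R : Vec Bool n → Set) → R (Vec.replicate n false) →
                   (∀ v a → R v → R (toggle v a)) → ∀ v → R v
toggle-generates {zero}  R r₀ step Vec.[] = r₀
toggle-generates {suc n} R r₀ step (b Vec.∷ v) = with-head b
  where
  with-false : ∀ u → R (false Vec.∷ u)
  with-false = toggle-generates (λ u → R (false Vec.∷ u)) r₀ (λ u a → step (false Vec.∷ u) (Fin.suc a))
  with-head : ∀ b → R (b Vec.∷ v)
  with-head false = with-false v
  with-head true  = subst R toggle-head (step (false Vec.∷ v) Fin.zero (with-false v))
    where
    toggle-head : toggle (false Vec.∷ v) Fin.zero ≡ true Vec.∷ v
    toggle-head = cong (true Vec.∷_) (trans (tabulate-cong λ b → Bool.xor-identityʳ (lookup v b)) (tabulate∘lookup v))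

members : ∀ {n} → Vec Bool n → List (Fin n)
members v = filter (λ b → lookup v b Bool.≟ true) (allFin _)

∈-members : ∀ {n} (v : Vec Bool n) {b} → b ∈ members v ⇔ lookup v b ≡ true
∈-members {n} v = mk⇔ (λ b∈ → proj₂ (∈-filter⁻ (λ b → lookup v b Bool.≟ true) {xs = allFin n} b∈))
                  (∈-filter⁺ (λ b → lookup v b Bool.≟ true) (∈-allFin _))

dec⇔does : ∀ {A : Set} (a? : Dec A) → A ⇔ (does a? ≡ true)
dec⇔does (yes a) = mk⇔ (λ _ → refl) (λ _ → a)
dec⇔does (no ¬a) = mk⇔ (λ a → contradiction a ¬a) (λ ())

does-cong : ∀ {A B : Set} → A ⇔ B → (a? : Dec A) (b? : Dec B) → does a? ≡ does b?
does-cong A⇔B (yes a) (yes b) = refl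
does-cong A⇔B (no ¬a) (no ¬b) = refl
does-cong A⇔B (yes a) (no ¬b) = contradiction (to A⇔B a) ¬b
does-cong A⇔B (no ¬a) (yes b) = contradiction (from A⇔B b) ¬a

does-≡ : ∀ {A : Set} {β} → A ⇔ (β ≡ true) → (a? : Dec A) → does a? ≡ β
does-≡ {β = true}  A⇔β (yes a) = refl
does-≡ {β = false} A⇔β (yes a) = sym (to A⇔β a)
does-≡ {β = true}  A⇔β (no ¬a) = contradiction (from A⇔β refl) ¬a
does-≡ {β = false} A⇔β (no ¬a) = refl

¬⊎⇔→ : ∀ {A B : Set} → Dec A → (¬ A ⊎ B) ⇔ (A → B)
¬⊎⇔→ (yes a) = mk⇔ (λ where (inj₁ ¬a) a → contradiction a ¬a ; (inj₂ b) _ → b) (λ f → inj₂ (f a))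
¬⊎⇔→ (no ¬a) = mk⇔ (λ where (inj₁ ¬a) a → contradiction a ¬a ; (inj₂ b) _ → b) (λ _ → inj₁ ¬a)

Π⇔ : ∀ {A : Set} {P Q : A → Set} → (∀ x → P x ⇔ Q x) → (∀ x → P x) ⇔ (∀ x → Q x)
Π⇔ P⇔Q = mk⇔ (λ p x → to (P⇔Q x) (p x)) (λ q x → from (P⇔Q x) (q x))

Σ⇔ : ∀ {A : Set} {P Q : A → Set} → (∀ x → P x ⇔ Q x) → (∃ P) ⇔ (∃ Q)
Σ⇔ P⇔Q = mk⇔ (λ (x , p) → x , to (P⇔Q x) p) (λ (x , q) → x , from (P⇔Q x) q)

both⇔≡ : ∀ {P Q : Set} {α β} → P ⇔ (α ≡ true) → Q ⇔ (β ≡ true) →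
         ((P × Q) ⊎ (¬ P × ¬ Q)) ⇔ (α ≡ β)
both⇔≡ {α = true}  {true}  p q = mk⇔ (λ _ → refl) (λ _ → inj₁ (from p refl , from q refl))
both⇔≡ {α = false} {false} p q =
  mk⇔ (λ _ → refl) (λ _ → inj₂ ((λ a → contradiction (to p a) λ ()) , (λ b → contradiction (to q b) λ ())))
both⇔≡ {α = true}  {false} p q =
  mk⇔ (λ where (inj₁ (_ , b)) → sym (to q b) ; (inj₂ (¬a , _)) → contradiction (from p refl) ¬a) λ ()
both⇔≡ {α = false} {true}  p q =
  mk⇔ (λ where (inj₁ (a , _)) → to p a ; (inj₂ (_ , ¬b)) → contradiction (from q refl) ¬b) λ ()

exactlyOne⇔xor : ∀ {P Q : Set} {α β} → P ⇔ (α ≡ true) → Q ⇔ (β ≡ true) →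
                 ((P × ¬ Q) ⊎ (¬ P × Q)) ⇔ (α xor β ≡ true)
exactlyOne⇔xor {α = true}  {true}  p q =
  mk⇔ (λ where
         (inj₁ (_ , ¬b)) → contradiction (from q refl) ¬b
         (inj₂ (¬a , _)) → contradiction (from p refl) ¬a)
      λ ()
exactlyOne⇔xor {α = false} {false} p q =
  mk⇔ (λ where (inj₁ (a , _)) → to p a ; (inj₂ (_ , b)) → to q b) λ ()
exactlyOne⇔xor {α = true}  {false} p q =
  mk⇔ (λ _ → refl) (λ _ → inj₁ (from p refl , λ b → contradiction (to q b) λ ()))
exactlyOne⇔xor {α = false} {true}  p q =
  mk⇔ (λ _ → refl) (λ _ → inj₂ ((λ a → contradiction (to p a) λ ()) , from q refl))

least : {P : ℕ → Set} → Decidable P → ∀ {n} → P n → ∃ λ m → P m × (∀ {k} → P k → m ≤ k)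
least {P} P? = <-rec (λ n → P n → Least) search _
  where
  Least : Set
  Least = ∃ λ m → P m × (∀ {k} → P k → m ≤ k)
  search : ∀ n → (∀ {m} → m < n → P m → Least) → P n → Least
  search n below pn with ℕ.anyUpTo? P? n
  ... | yes (m , m<n , pm) = below m<n pm
  ... | no  none           = n , pn , λ pk → ℕ.≮⇒≥ λ k<n → none (_ , k<n , pk)

OfLength : ℕ → (List Letter → Set) → Set
OfLength n P = ∃ λ xs → length xs ≡ n × P xs

ofLength? : ∀ n {P} → Decidable P → Dec (OfLength n P)
ofLength? zero    P? = map′ (λ p → [] , refl , p) (λ where ([] , _ , p) → p) (P? [])
ofLength? (suc n) {P} P? =
  map′ cons uncons (ofLength? n (λ xs → P? (l ∷ xs)) ⊎-dec ofLength? n (λ xs → P? (r ∷ xs)))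
  where
  cons : OfLength n (λ xs → P (l ∷ xs)) ⊎ OfLength n (λ xs → P (r ∷ xs)) → OfLength (suc n) P
  cons (inj₁ (xs , e , p)) = l ∷ xs , cong suc e , p
  cons (inj₂ (xs , e , p)) = r ∷ xs , cong suc e , p
  uncons : OfLength (suc n) P → OfLength n (λ xs → P (l ∷ xs)) ⊎ OfLength n (λ xs → P (r ∷ xs))
  uncons (l ∷ xs , e , p) = inj₁ (xs , ℕ.suc-injective e , p)
  uncons (r ∷ xs , e , p) = inj₂ (xs , ℕ.suc-injective e , p)

drop-lookup : ∀ {A : Set} (xs : List A) (p : Fin (length xs)) →
              drop (toℕ p) xs ≡ List.lookup xs p ∷ drop (suc (toℕ p)) xs
drop-lookup (x ∷ xs) Fin.zero    = refl
drop-lookup (x ∷ xs) (Fin.suc p) = drop-lookup xs p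

drop-∷⇒< : ∀ {A : Set} k (xs : List A) {y ys} → drop k xs ≡ y ∷ ys → k < length xs
drop-∷⇒< zero    (x ∷ xs) _ = s≤s z≤n
drop-∷⇒< (suc k) (x ∷ xs) e = s≤s (drop-∷⇒< k xs e)

drop-length-++ : ∀ {A : Set} (xs : List A) {ys} → drop (length xs) (xs ++ ys) ≡ ys
drop-length-++ []       = refl
drop-length-++ (x ∷ xs) = drop-length-++ xs

tower-mono : ∀ {m n} → m ≤ n → tower m ≤ tower n
tower-mono {zero}  {zero}  _         = ℕ.≤-refl
tower-mono {zero}  {suc n} _         = ℕ.m^n>0 2 (tower n)
tower-mono {suc m} {suc n} (s≤s m≤n) = ℕ.^-monoʳ-≤ 2 (tower-mono m≤n)

update-same : ∀ {w} ρ x p → update w ρ x p x ≡ p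
update-same ρ x p with x ℕ.≟ x
... | yes _  = refl
... | no x≢x = contradiction refl x≢x

update-other : ∀ {w} ρ x p {v} → v ≢ x → update w ρ x p v ≡ ρ v
update-other ρ x p {v} v≢x with v ℕ.≟ x
... | yes v≡x = contradiction v≡x v≢x
... | no _    = refl

_≟ˡ_ : (a b : Letter) → Dec (a ≡ b)
l ≟ˡ l = yes refl
r ≟ˡ r = yes refl
l ≟ˡ r = no λ ()
r ≟ˡ l = no λ ()

sat? : ∀ w ρ φ → Dec (Sat w ρ φ)
sat? w ρ (x ≐ y)  = ρ x ≟ ρ y
sat? w ρ (x ≺ y)  = toℕ (ρ x) ℕ.<? toℕ (ρ y)
sat? w ρ (Pl x)   = letterAt w (ρ x) ≟ˡ l
sat? w ρ (Pr x)   = letterAt w (ρ x) ≟ˡ r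
sat? w ρ (φ ∧ᶠ ψ) = sat? w ρ φ ×-dec sat? w ρ ψ
sat? w ρ (φ ∨ᶠ ψ) = sat? w ρ φ ⊎-dec sat? w ρ ψ
sat? w ρ (¬ᶠ φ)   = ¬? (sat? w ρ φ)
sat? w ρ (∃ᶠ x φ) = any? λ p → sat? w (update w ρ x p) φ
sat? w ρ (∀ᶠ x φ) = all? λ p → sat? w (update w ρ x p) φ

models-of-length? : ∀ {φ} → (∀ w → Dec (w ⊨ φ)) → ∀ n → Dec (∃ λ w → w ⊨ φ × List⁺.length w ≡ n)
models-of-length? ⊨? zero      = no λ ()
models-of-length? {φ} ⊨? (suc n) =
  map′ cons uncons (ofLength? n λ xs → ⊨? (l List⁺.∷ xs) ⊎-dec ⊨? (r List⁺.∷ xs))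
  where
  cons : OfLength n (λ xs → (l List⁺.∷ xs) ⊨ φ ⊎ (r List⁺.∷ xs) ⊨ φ) →
         ∃ λ w → w ⊨ φ × List⁺.length w ≡ suc n
  cons (xs , xs≡n , inj₁ ⊨φ) = l List⁺.∷ xs , ⊨φ , cong suc xs≡n
  cons (xs , xs≡n , inj₂ ⊨φ) = r List⁺.∷ xs , ⊨φ , cong suc xs≡n
  uncons : (∃ λ w → w ⊨ φ × List⁺.length w ≡ suc n) →
           OfLength n (λ xs → (l List⁺.∷ xs) ⊨ φ ⊎ (r List⁺.∷ xs) ⊨ φ)
  uncons (l List⁺.∷ xs , ⊨φ , w≡1+n) = xs , ℕ.suc-injective w≡1+n , inj₁ ⊨φ
  uncons (r List⁺.∷ xs , ⊨φ , w≡1+n) = xs , ℕ.suc-injective w≡1+n , inj₂ ⊨φ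

μ-of-satisfiable : ∀ {φ} → (∀ w → Dec (w ⊨ φ)) → ∀ {w} → w ⊨ φ →
                   ∃ λ m → IsMu φ m × ∃ λ w′ → w′ ⊨ φ × List⁺.length w′ ≡ m
μ-of-satisfiable ⊨? {w} w⊨ =
  let m , shortest , minimal = least (models-of-length? ⊨?) (w , w⊨ , refl)
  in m , inj₂ (shortest , λ v v⊨ → minimal (v , v⊨ , refl)) , shortest

-- Formulas with parameters use the variables 0 and 1 for them; φ ⟨ a ⨾ b ⟩ instantiates them with a and b.
succF : Formula
succF = (0 ≺ 1) ∧ᶠ (¬ᶠ ∃ᶠ 2 ((0 ≺ 2) ∧ᶠ (2 ≺ 1)))

infix 25 _⟨_⟩ _⟨_⨾_⟩

_⟨_⟩ : Formula → Var → Formula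
φ ⟨ v ⟩ = ∃ᶠ 0 ((0 ≐ v) ∧ᶠ φ)

_⟨_⨾_⟩ : Formula → Var → Var → Formula
φ ⟨ a ⨾ b ⟩ = ∃ᶠ 0 ((0 ≐ a) ∧ᶠ ∃ᶠ 1 ((1 ≐ b) ∧ᶠ φ))

iffF : Formula → Formula → Formula
iffF φ ψ = (φ ∧ᶠ ψ) ∨ᶠ ((¬ᶠ φ) ∧ᶠ (¬ᶠ ψ))

xorF : Formula → Formula → Formula
xorF φ ψ = (φ ∧ᶠ (¬ᶠ ψ)) ∨ᶠ ((¬ᶠ φ) ∧ᶠ ψ)

lsAfterF : ℕ → Formula
lsAfterF zero    = 0 ≐ 0
lsAfterF (suc m) = ∃ᶠ 1 (succF ∧ᶠ (Pl 1 ∧ᶠ lsAfterF m ⟨ 1 ⟩))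

markerF : ℕ → Formula
markerF m = Pr 0 ∧ᶠ lsAfterF m

withinBlockF : Formula → Formula → Formula
withinBlockF μ ν =
  μ ⟨ 1 ⟩ ∧ᶠ ((0 ≺ 1) ∧ᶠ ∀ᶠ 2 ((¬ᶠ ((0 ≺ 2) ∧ᶠ (¬ᶠ (1 ≺ 2)))) ∨ᶠ (¬ᶠ ν ⟨ 2 ⟩)))

memberF : Formula → Formula → Var → Var → Var → Formula
memberF C E t x u = ∃ᶠ u (C ⟨ x ⨾ u ⟩ ∧ᶠ E ⟨ t ⨾ u ⟩)

-- Both inclusions are checked under one ∀ over the pairs (x₀, x₁) and (x₁, x₀), so sameCodeF (suc i)
-- contains sameCodeF i only once and has size O(i²).
extensionalF : Formula → Formula → Formula
extensionalF C E =
  ∀ᶠ 2 (∀ᶠ 3 ((¬ᶠ (((2 ≐ 0) ∧ᶠ (3 ≐ 1)) ∨ᶠ ((2 ≐ 1) ∧ᶠ (3 ≐ 0)))) ∨ᶠ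
              ∀ᶠ 4 ((¬ᶠ C ⟨ 2 ⨾ 4 ⟩) ∨ᶠ memberF C E 4 3 5)))

childlessF : Formula → Formula
childlessF C = ∃ᶠ 6 (¬ᶠ ∃ᶠ 7 (C ⟨ 6 ⨾ 7 ⟩))

toggleF : Formula → Formula → Formula
toggleF C E =
  ∀ᶠ 6 (∀ᶠ 7 (∃ᶠ 8 (∀ᶠ 9 (iffF (memberF C E 9 8 10) (xorF (memberF C E 9 6 11) (E ⟨ 9 ⨾ 7 ⟩))))))

childF : ℕ → Formula
childF i = withinBlockF (markerF i) (markerF (suc i))

sameCodeF : ℕ → Formula
sameCodeF zero    = 0 ≐ 0
sameCodeF (suc i) = extensionalF (childF i) (sameCodeF i)

towerF : ℕ → Formula
towerF zero    = ∀ᶠ 0 (0 ≐ 0)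
towerF (suc k) = towerF k ∧ᶠ (childlessF (childF k) ∧ᶠ toggleF (childF k) (sameCodeF k))

record Scoped (Γ : List Var) (φ : Formula) : Set where
  constructor scoped
  field free⇒∈ : ∀ {v} → FreeIn v φ → v ∈ Γ
open Scoped

Scoped₁ Scoped₂ : Formula → Set
Scoped₁ φ = ∀ {Γ} → 0 ∈ Γ → Scoped Γ φ
Scoped₂ φ = ∀ {Γ} → 0 ∈ Γ → 1 ∈ Γ → Scoped Γ φ

private variable
  Γ : List Var

scoped-≐ : ∀ {x y} → x ∈ Γ → y ∈ Γ → Scoped Γ (x ≐ y)
scoped-≐ x∈Γ y∈Γ = scoped λ where (inj₁ refl) → x∈Γ ; (inj₂ refl) → y∈Γ

scoped-≺ : ∀ {x y} → x ∈ Γ → y ∈ Γ → Scoped Γ (x ≺ y)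
scoped-≺ x∈Γ y∈Γ = scoped λ where (inj₁ refl) → x∈Γ ; (inj₂ refl) → y∈Γ

scoped-Pl : ∀ {x} → x ∈ Γ → Scoped Γ (Pl x)
scoped-Pl x∈Γ = scoped λ where refl → x∈Γ

scoped-Pr : ∀ {x} → x ∈ Γ → Scoped Γ (Pr x)
scoped-Pr x∈Γ = scoped λ where refl → x∈Γ

scoped-∧ : ∀ {φ ψ} → Scoped Γ φ → Scoped Γ ψ → Scoped Γ (φ ∧ᶠ ψ)
scoped-∧ sφ sψ = scoped λ where (inj₁ free) → free⇒∈ sφ free ; (inj₂ free) → free⇒∈ sψ free

scoped-∨ : ∀ {φ ψ} → Scoped Γ φ → Scoped Γ ψ → Scoped Γ (φ ∨ᶠ ψ)
scoped-∨ sφ sψ = scoped λ where (inj₁ free) → free⇒∈ sφ free ; (inj₂ free) → free⇒∈ sψ free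

scoped-¬ : ∀ {φ} → Scoped Γ φ → Scoped Γ (¬ᶠ φ)
scoped-¬ sφ = scoped (free⇒∈ sφ)

scoped-∃ : ∀ {x φ} → Scoped (x ∷ Γ) φ → Scoped Γ (∃ᶠ x φ)
scoped-∃ sφ = scoped λ (v≢x , free) → unbind v≢x (free⇒∈ sφ free)
  where
  unbind : ∀ {v x} → v ≢ x → v ∈ x ∷ Γ → v ∈ Γ
  unbind v≢x (here v≡x)  = contradiction v≡x v≢x
  unbind v≢x (there v∈Γ) = v∈Γ

scoped-∀ : ∀ {x φ} → Scoped (x ∷ Γ) φ → Scoped Γ (∀ᶠ x φ)
scoped-∀ sφ = scoped (free⇒∈ (scoped-∃ sφ))

scoped-iffF : ∀ {φ ψ} → Scoped Γ φ → Scoped Γ ψ → Scoped Γ (iffF φ ψ)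
scoped-iffF sφ sψ = scoped-∨ (scoped-∧ sφ sψ) (scoped-∧ (scoped-¬ sφ) (scoped-¬ sψ))

scoped-xorF : ∀ {φ ψ} → Scoped Γ φ → Scoped Γ ψ → Scoped Γ (xorF φ ψ)
scoped-xorF sφ sψ = scoped-∨ (scoped-∧ sφ (scoped-¬ sψ)) (scoped-∧ (scoped-¬ sφ) sψ)

scoped-⟨⟩ : ∀ {φ v} → Scoped₁ φ → v ∈ Γ → Scoped Γ (φ ⟨ v ⟩)
scoped-⟨⟩ sφ v∈Γ = scoped-∃ (scoped-∧ (scoped-≐ (here refl) (there v∈Γ)) (sφ (here refl)))

scoped-⟨⨾⟩ : ∀ {φ a b} → Scoped₂ φ → a ∈ Γ → b ∈ Γ → Scoped Γ (φ ⟨ a ⨾ b ⟩)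
scoped-⟨⨾⟩ sφ a∈Γ b∈Γ =
  scoped-∃ (scoped-∧ (scoped-≐ (here refl) (there a∈Γ))
    (scoped-∃ (scoped-∧ (scoped-≐ (here refl) (there (there b∈Γ)))
      (sφ (there (here refl)) (here refl)))))

sentence : ∀ {φ} → Scoped [] φ → Sentence φ
sentence sφ v free with () ← free⇒∈ sφ free

scoped-succF : Scoped₂ succF
scoped-succF x₀ x₁ =
  scoped-∧ (scoped-≺ x₀ x₁) (scoped-¬ (scoped-∃ (scoped-∧ (scoped-≺ (there x₀) (here refl))
                                                             (scoped-≺ (here refl) (there x₁)))))

scoped-lsAfterF : ∀ m → Scoped₁ (lsAfterF m)
scoped-lsAfterF zero    x₀ = scoped-≐ x₀ x₀
scoped-lsAfterF (suc m) x₀ =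
  scoped-∃ (scoped-∧ (scoped-succF (there x₀) (here refl))
           (scoped-∧ (scoped-Pl (here refl)) (scoped-⟨⟩ (scoped-lsAfterF m) (here refl))))

scoped-markerF : ∀ m → Scoped₁ (markerF m)
scoped-markerF m x₀ = scoped-∧ (scoped-Pr x₀) (scoped-lsAfterF m x₀)

scoped-withinBlockF : ∀ {μ ν} → Scoped₁ μ → Scoped₁ ν → Scoped₂ (withinBlockF μ ν)
scoped-withinBlockF sμ sν x₀ x₁ =
  scoped-∧ (scoped-⟨⟩ sμ x₁) (scoped-∧ (scoped-≺ x₀ x₁) (scoped-∀
    (scoped-∨ (scoped-¬ (scoped-∧ (scoped-≺ (there x₀) (here refl)) (scoped-¬ (scoped-≺ (there x₁) (here refl)))))
              (scoped-¬ (scoped-⟨⟩ sν (here refl))))))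

scoped-memberF : ∀ {C E Γ t x u} → Scoped₂ C → Scoped₂ E → t ∈ Γ → x ∈ Γ → Scoped Γ (memberF C E t x u)
scoped-memberF sC sE t∈Γ x∈Γ =
  scoped-∃ (scoped-∧ (scoped-⟨⨾⟩ sC (there x∈Γ) (here refl)) (scoped-⟨⨾⟩ sE (there t∈Γ) (here refl)))

scoped-extensionalF : ∀ {C E} → Scoped₂ C → Scoped₂ E → Scoped₂ (extensionalF C E)
scoped-extensionalF sC sE {Γ} x₀ x₁ =
  scoped-∀ (scoped-∀ (scoped-∨
    (scoped-¬ (scoped-∨ (scoped-∧ (scoped-≐ x₂ x₀′) (scoped-≐ x₃ x₁′))
                        (scoped-∧ (scoped-≐ x₂ x₁′) (scoped-≐ x₃ x₀′))))
    (scoped-∀ (scoped-∨ (scoped-¬ (scoped-⟨⨾⟩ sC (there x₂) (here refl)))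
                        (scoped-memberF sC sE (here refl) (there x₃))))))
  where
  x₀′ : 0 ∈ 3 ∷ 2 ∷ Γ
  x₀′ = there (there x₀)
  x₁′ : 1 ∈ 3 ∷ 2 ∷ Γ
  x₁′ = there (there x₁)
  x₂ : 2 ∈ 3 ∷ 2 ∷ Γ
  x₂ = there (here refl)
  x₃ : 3 ∈ 3 ∷ 2 ∷ Γ
  x₃ = here refl

scoped-childlessF : ∀ {C} → Scoped₂ C → Scoped [] (childlessF C)
scoped-childlessF sC = scoped-∃ (scoped-¬ (scoped-∃ (scoped-⟨⨾⟩ sC (there (here refl)) (here refl))))

scoped-toggleF : ∀ {C E} → Scoped₂ C → Scoped₂ E → Scoped [] (toggleF C E)
scoped-toggleF sC sE =
  scoped-∀ (scoped-∀ (scoped-∃ (scoped-∀ (scoped-iffF (scoped-memberF sC sE x₉ x₈)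
    (scoped-xorF (scoped-memberF sC sE x₉ x₆) (scoped-⟨⨾⟩ sE x₉ x₇))))))
  where
  x₉ : 9 ∈ 9 ∷ 8 ∷ 7 ∷ 6 ∷ []
  x₉ = here refl
  x₈ : 8 ∈ 9 ∷ 8 ∷ 7 ∷ 6 ∷ []
  x₈ = there (here refl)
  x₇ : 7 ∈ 9 ∷ 8 ∷ 7 ∷ 6 ∷ []
  x₇ = there (there (here refl))
  x₆ : 6 ∈ 9 ∷ 8 ∷ 7 ∷ 6 ∷ []
  x₆ = there (there (there (here refl)))

scoped-childF : ∀ i → Scoped₂ (childF i)
scoped-childF i = scoped-withinBlockF (scoped-markerF i) (scoped-markerF (suc i))

scoped-sameCodeF : ∀ i → Scoped₂ (sameCodeF i)
scoped-sameCodeF zero    x₀ x₁ = scoped-≐ x₀ x₀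
scoped-sameCodeF (suc i) = scoped-extensionalF (scoped-childF i) (scoped-sameCodeF i)

scoped-towerF : ∀ k → Scoped [] (towerF k)
scoped-towerF zero    = scoped-∀ (scoped-≐ (here refl) (here refl))
scoped-towerF (suc k) =
  scoped-∧ (scoped-towerF k) (scoped-∧ (scoped-childlessF (scoped-childF k))
                                       (scoped-toggleF (scoped-childF k) (scoped-sameCodeF k)))

-- Abstracting the sizes of the subformulas leaves identities that the ring solver can check.
sz-lsAfterF : ∀ m → sz (lsAfterF m) ≡ 14 * m + 1
sz-lsAfterF zero = refl
sz-lsAfterF (suc m) with sz (lsAfterF m) | sz-lsAfterF m
... | _ | refl = solve (m ∷ [])

sz-extensionalF : ∀ C E → sz (extensionalF C E) ≡ 2 * sz C + sz E + 34
sz-extensionalF C E with sz C | sz E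
... | c | e = solve (c ∷ e ∷ [])

sz-towerStep : ∀ T C E → sz (T ∧ᶠ (childlessF C ∧ᶠ toggleF C E)) ≡ sz T + 7 * sz C + 10 * sz E + 138
sz-towerStep T C E with sz T | sz C | sz E
... | t | c | e = solve (t ∷ c ∷ e ∷ [])

sz-childF : ∀ i → sz (childF i) ≡ 28 * i + 37
sz-childF i with sz (lsAfterF i) | sz-lsAfterF i
... | _ | refl = solve (i ∷ [])

sz-sameCodeF : ∀ i → sz (sameCodeF i) ≡ 28 * (i * i) + 80 * i + 1
sz-sameCodeF zero    = refl
sz-sameCodeF (suc i) = begin
  sz (sameCodeF (suc i))
    ≡⟨ sz-extensionalF (childF i) (sameCodeF i) ⟩
  2 * sz (childF i) + sz (sameCodeF i) + 34
    ≡⟨ cong₂ (λ c e → 2 * c + e + 34) (sz-childF i) (sz-sameCodeF i) ⟩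
  2 * (28 * i + 37) + (28 * (i * i) + 80 * i + 1) + 34
    ≡⟨ solve (i ∷ []) ⟩
  28 * (suc i * suc i) + 80 * suc i + 1 ∎
  where open ≡-Reasoning

cubic-increment : ∀ j → 409 * j ^ 3 + 7 * (28 * j + 37) + 10 * (28 * (j * j) + 80 * j + 1) + 138
                        ≤ 409 * suc j ^ 3
cubic-increment j = begin
  409 * j ^ 3 + 7 * (28 * j + 37) + 10 * (28 * (j * j) + 80 * j + 1) + 138
    ≤⟨ ℕ.m≤m+n _ (947 * (j * j) + 231 * j + 2) ⟩
  -- the ring solver does not interpret _^_, so the cubes are unfolded
  409 * (j * (j * (j * 1))) + 7 * (28 * j + 37) + 10 * (28 * (j * j) + 80 * j + 1) + 138
    + (947 * (j * j) + 231 * j + 2)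
    ≡⟨ solve (j ∷ []) ⟩
  409 * ((1 + j) * ((1 + j) * ((1 + j) * 1))) ∎
  where open ℕ.≤-Reasoning

sz-towerF : ∀ k → sz (towerF (suc k)) ≤ 409 * suc k ^ 3
sz-towerF zero    = ℕ.≤-refl
sz-towerF (suc k) = begin
  sz (towerF (suc j))
    ≡⟨ sz-towerStep (towerF j) (childF j) (sameCodeF j) ⟩
  sz (towerF j) + 7 * sz (childF j) + 10 * sz (sameCodeF j) + 138
    ≡⟨ cong₂ (λ c e → sz (towerF j) + 7 * c + 10 * e + 138) (sz-childF j) (sz-sameCodeF j) ⟩
  sz (towerF j) + 7 * (28 * j + 37) + 10 * (28 * (j * j) + 80 * j + 1) + 138
    ≤⟨ ℕ.+-monoˡ-≤ 138 (ℕ.+-monoˡ-≤ _ (ℕ.+-monoˡ-≤ _ (sz-towerF k))) ⟩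
  409 * j ^ 3 + 7 * (28 * j + 37) + 10 * (28 * (j * j) + 80 * j + 1) + 138
    ≤⟨ cubic-increment j ⟩
  409 * suc j ^ 3 ∎
  where
  j : ℕ
  j = suc k
  open ℕ.≤-Reasoning

startsWithLs : ℕ → List Letter → Bool
startsWithLs zero    _        = true
startsWithLs (suc m) (l ∷ ys) = startsWithLs m ys
startsWithLs (suc m) (r ∷ ys) = false
startsWithLs (suc m) []       = false

isMarker : ℕ → List Letter → Bool
isMarker m (r ∷ ys) = startsWithLs m ys
isMarker m (l ∷ ys) = false
isMarker m []       = false

_∈?_ : ∀ {n} (b : Fin n) (bs : List (Fin n)) → Dec (b ∈ bs)
b ∈? bs = Any.any? (b ≟_) bs

children : ∀ i → List Letter → List (Fin (tower i))
code     : ∀ i → List Letter → Fin (tower i)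

children i []       = []
children i (y ∷ ys) =
  if isMarker (suc i) (y ∷ ys) then [] else
  if isMarker i (y ∷ ys) then code i ys ∷ children i ys else children i ys

code zero    _  = Fin.zero
code (suc i) ys = fromBits (tabulate λ b → does (b ∈? children i ys))

BlockChild : ℕ → List Letter → ℕ → Set
BlockChild i ys d = isMarker i (drop d ys) ≡ true × (∀ {e} → e ≤ d → isMarker (suc i) (drop e ys) ≡ false)

BlockChild-suc : ∀ {i y ys d} → isMarker (suc i) (y ∷ ys) ≡ false →
                 BlockChild i ys d → BlockChild i (y ∷ ys) (suc d)
BlockChild-suc open₀ (marked , unblocked) = marked , λ where
  z≤n       → open₀
  (s≤s e≤d) → unblocked e≤d

BlockChild-pred : ∀ {i y ys d} → BlockChild i (y ∷ ys) (suc d) → BlockChild i ys d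
BlockChild-pred (marked , unblocked) = marked , λ e≤d → unblocked (s≤s e≤d)

ChildCode : ∀ i → List Letter → Fin (tower i) → Set
ChildCode i ys b = ∃ λ d → BlockChild i ys d × code i (drop (suc d) ys) ≡ b

∈-children : ∀ i ys {b} → b ∈ children i ys ⇔ ChildCode i ys b
∈-children i [] = mk⇔ (λ ()) λ (d , (marked , _) , _) → contradiction marked (no-marker d)
  where
  no-marker : ∀ d → isMarker i (drop d []) ≢ true
  no-marker d rewrite drop-[] {A = Letter} d = λ ()
∈-children i (y ∷ ys) {b} with isMarker (suc i) (y ∷ ys) in closed | isMarker i (y ∷ ys) in marked
... | true  | _     = mk⇔ (λ ()) λ (_ , (_ , unblocked) , _) → contradiction (trans (sym (unblocked z≤n)) closed) λ ()
... | false | true  = mk⇔ sound complete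
  where
  sound : b ∈ code i ys ∷ children i ys → ChildCode i (y ∷ ys) b
  sound (here refl) = 0 , (marked , λ where z≤n → closed) , refl
  sound (there b∈)  = let d , child , eq = to (∈-children i ys) b∈ in suc d , BlockChild-suc closed child , eq
  complete : ChildCode i (y ∷ ys) b → b ∈ code i ys ∷ children i ys
  complete (zero  , _     , refl) = here refl
  complete (suc d , child , eq)   = there (from (∈-children i ys) (d , BlockChild-pred child , eq))
... | false | false = mk⇔ sound complete
  where
  sound : b ∈ children i ys → ChildCode i (y ∷ ys) b
  sound b∈ = let d , child , eq = to (∈-children i ys) b∈ in suc d , BlockChild-suc closed child , eq
  complete : ChildCode i (y ∷ ys) b → b ∈ children i ys
  complete (zero  , (marked′ , _) , _) with () ← trans (sym marked) marked′
  complete (suc d , child , eq) = from (∈-children i ys) (d , BlockChild-pred child , eq)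

module Definability (w : Word) where

  letters : List Letter
  letters = List⁺.toList w

  suffixFrom suffixAfter : Pos w → List Letter
  suffixFrom  x = drop (toℕ x) letters
  suffixAfter x = drop (suc (toℕ x)) letters

  suffixFrom-∷ : ∀ x → suffixFrom x ≡ letterAt w x ∷ suffixAfter x
  suffixFrom-∷ = drop-lookup letters

  position : ∀ {k} → k < List⁺.length w → Σ (Pos w) λ x → toℕ x ≡ k
  position k<n = fromℕ< k<n , toℕ-fromℕ< k<n

  position-of-suffix : ∀ {k y ys} → drop k letters ≡ y ∷ ys → Σ (Pos w) λ x → toℕ x ≡ k
  position-of-suffix {k} e = position (drop-∷⇒< k letters e)

  record Defines₁ (φ : Formula) (S : Pos w → Set) : Set where
    constructor defines₁
    field sat⇔₁ : ∀ ρ → Sat w ρ φ ⇔ S (ρ 0)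

  record Defines₂ (φ : Formula) (R : Pos w → Pos w → Set) : Set where
    constructor defines₂
    field sat⇔₂ : ∀ ρ → Sat w ρ φ ⇔ R (ρ 0) (ρ 1)

  open Defines₁
  open Defines₂

  defines-succF : Defines₂ succF λ x y → toℕ y ≡ suc (toℕ x)
  defines-succF = defines₂ λ ρ → mk⇔ (sound ρ) (complete ρ)
    where
    sound : ∀ ρ → Sat w ρ succF → toℕ (ρ 1) ≡ suc (toℕ (ρ 0))
    sound ρ (x<y , nothing-between) with ℕ.m≤n⇒m<n∨m≡n x<y
    ... | inj₂ 1+x≡y   = sym 1+x≡y
    ... | inj₁ 1+x<y =
      let z , z≡1+x = position (ℕ.<-trans 1+x<y (toℕ<n (ρ 1))) in
      contradiction (z , ℕ.≤-reflexive (sym z≡1+x) , subst (_< toℕ (ρ 1)) (sym z≡1+x) 1+x<y) nothing-between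
    complete : ∀ ρ → toℕ (ρ 1) ≡ suc (toℕ (ρ 0)) → Sat w ρ succF
    complete ρ y≡1+x = ℕ.≤-reflexive (sym y≡1+x) , λ (z , x<z , z<y) →
      ℕ.1+n≰n (ℕ.≤-trans (s≤s x<z) (subst (suc (toℕ z) ≤_) y≡1+x z<y))

  -- The side conditions False (v ≟ 0) reduce to ⊤ at numerals and are then inferred.
  defines-⟨⟩ : ∀ {φ S} → Defines₁ φ S →
               ∀ {v} {_ : False (v ℕ.≟ 0)} ρ → Sat w ρ (φ ⟨ v ⟩) ⇔ S (ρ v)
  defines-⟨⟩ {S = S} φ⇔S {v} {v≢0} ρ = mk⇔
    (λ (p , p≡v , s) → subst S (trans p≡v v-unchanged) (to (sat⇔₁ φ⇔S _) s))
    (λ s → ρ v , sym v-unchanged , from (sat⇔₁ φ⇔S _) s)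
    where
    v-unchanged : ∀ {p} → update w ρ 0 p v ≡ ρ v
    v-unchanged = update-other ρ 0 _ (toWitnessFalse v≢0)

  defines-⟨⨾⟩ : ∀ {φ R} → Defines₂ φ R →
                ∀ {a b} {_ : False (a ℕ.≟ 0)} {_ : False (b ℕ.≟ 0)} {_ : False (b ℕ.≟ 1)} ρ →
                Sat w ρ (φ ⟨ a ⨾ b ⟩) ⇔ R (ρ a) (ρ b)
  defines-⟨⨾⟩ {R = R} φ⇔R {a} {b} {a≢0} {b≢0} {b≢1} ρ = mk⇔
    (λ (p , p≡a , q , q≡b , s) →
       subst₂ R (trans p≡a a-unchanged) (trans q≡b b-unchanged) (to (sat⇔₂ φ⇔R _) s))
    (λ s → ρ a , sym a-unchanged , ρ b , sym b-unchanged , from (sat⇔₂ φ⇔R _) s)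
    where
    a-unchanged : ∀ {p} → update w ρ 0 p a ≡ ρ a
    a-unchanged = update-other ρ 0 _ (toWitnessFalse a≢0)
    b-unchanged : ∀ {p q} → update w (update w ρ 0 p) 1 q b ≡ ρ b
    b-unchanged = trans (update-other _ 1 _ (toWitnessFalse b≢1)) (update-other ρ 0 _ (toWitnessFalse b≢0))

  LsAfter : ℕ → Pos w → Set
  LsAfter m x = startsWithLs m (suffixAfter x) ≡ true

  defines-lsAfterF : ∀ m → Defines₁ (lsAfterF m) (LsAfter m)
  defines-lsAfterF zero    = defines₁ λ _ → mk⇔ (λ _ → refl) (λ _ → refl)
  defines-lsAfterF (suc m) = defines₁ λ ρ → mk⇔ (sound ρ) (complete ρ)
    where
    sound : ∀ ρ → Sat w ρ (lsAfterF (suc m)) → LsAfter (suc m) (ρ 0)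
    sound ρ (q , next , q-l , rest) =
      subst (λ ys → startsWithLs (suc m) ys ≡ true) (sym after-x)
            (to (defines-⟨⟩ (defines-lsAfterF m) {1} (update w ρ 1 q)) rest)
      where
      after-x : suffixAfter (ρ 0) ≡ l ∷ suffixAfter q
      after-x = trans (cong (λ k → drop k letters) (sym (to (sat⇔₂ defines-succF (update w ρ 1 q)) next)))
                      (trans (suffixFrom-∷ q) (cong (_∷ suffixAfter q) q-l))
    complete : ∀ ρ → LsAfter (suc m) (ρ 0) → Sat w ρ (lsAfterF (suc m))
    complete ρ starts with suffixAfter (ρ 0) in after-x
    ... | l ∷ ys with position-of-suffix after-x
    ...   | q , q≡1+x =
      q , from (sat⇔₂ defines-succF (update w ρ 1 q)) q≡1+x , ∷-injectiveˡ from-q ,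
      from (defines-⟨⟩ (defines-lsAfterF m) {1} (update w ρ 1 q))
           (subst (λ zs → startsWithLs m zs ≡ true) (sym (∷-injectiveʳ from-q)) starts)
      where
      from-q : letterAt w q ∷ suffixAfter q ≡ l ∷ ys
      from-q = trans (sym (suffixFrom-∷ q)) (trans (cong (λ k → drop k letters) q≡1+x) after-x)

  Marked : ℕ → Pos w → Set
  Marked m x = isMarker m (suffixFrom x) ≡ true

  defines-markerF : ∀ m → Defines₁ (markerF m) (Marked m)
  defines-markerF m = defines₁ sat⇔
    where
    sat⇔ : ∀ ρ → Sat w ρ (markerF m) ⇔ Marked m (ρ 0)
    sat⇔ ρ rewrite suffixFrom-∷ (ρ 0) with letterAt w (ρ 0)
    ... | r = mk⇔ (λ (_ , s) → to (sat⇔₁ (defines-lsAfterF m) ρ) s)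
                  (λ s → refl , from (sat⇔₁ (defines-lsAfterF m) ρ) s)
    ... | l = mk⇔ (λ { (() , _) }) (λ ())

  InBlock : (Pos w → Set) → (Pos w → Set) → Pos w → Pos w → Set
  InBlock M N x y = x Fin.< y × M y × (∀ z → x Fin.< z → z Fin.≤ y → ¬ N z)

  defines-withinBlockF : ∀ {μ ν M N} → Defines₁ μ M → Defines₁ ν N →
                         Defines₂ (withinBlockF μ ν) (InBlock M N)
  defines-withinBlockF μ⇔M ν⇔N = defines₂ λ ρ → mk⇔
    (λ (sμ , x<y , unblocked) → x<y , to (defines-⟨⟩ μ⇔M {1} ρ) sμ , λ z x<z z≤y Nz →
       to (¬⊎⇔→ (between? ρ z)) (unblocked z) (x<z , ℕ.≤⇒≯ z≤y) (from (defines-⟨⟩ ν⇔N {2} _) Nz))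
    (λ (x<y , My , free) → from (defines-⟨⟩ μ⇔M {1} ρ) My , x<y , λ z →
       from (¬⊎⇔→ (between? ρ z)) λ (x<z , y≮z) sν →
         free z x<z (ℕ.≮⇒≥ y≮z) (to (defines-⟨⟩ ν⇔N {2} _) sν))
    where
    between? : ∀ ρ z → Dec (ρ 0 Fin.< z × ¬ (ρ 1 Fin.< z))
    between? ρ z = (toℕ (ρ 0) ℕ.<? toℕ z) ×-dec ¬? (toℕ (ρ 1) ℕ.<? toℕ z)

  Child : ℕ → Pos w → Pos w → Set
  Child i = InBlock (Marked i) (Marked (suc i))

  defines-childF : ∀ i → Defines₂ (childF i) (Child i)
  defines-childF i = defines-withinBlockF (defines-markerF i) (defines-markerF (suc i))

  childrenOf : ∀ i → Pos w → List (Fin (tower i))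
  childrenOf i x = children i (suffixAfter x)

  codeAt : ∀ i → Pos w → Fin (tower i)
  codeAt i x = code i (suffixAfter x)

  offset : ∀ {x c : Pos w} → x Fin.< c → ∃ λ d → toℕ c ≡ suc (toℕ x) + d
  offset x<c = let d , 1+x+d≡c = ℕ.m≤n⇒∃[o]m+o≡n x<c in d , sym 1+x+d≡c

  offset-< : ∀ {x c : Pos w} d → toℕ c ≡ suc (toℕ x) + d → x Fin.< c
  offset-< {x} d c≡ = subst (suc (toℕ x) ≤_) (sym c≡) (ℕ.m≤m+n _ d)

  suffixFrom-offset : ∀ {x c} d → toℕ c ≡ suc (toℕ x) + d → suffixFrom c ≡ drop d (suffixAfter x)
  suffixFrom-offset {x} d c≡ =
    trans (cong (λ k → drop k letters) c≡) (sym (drop-drop (suc (toℕ x)) d letters))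

  suffixAfter-offset : ∀ {x c} d → toℕ c ≡ suc (toℕ x) + d → suffixAfter c ≡ drop (suc d) (suffixAfter x)
  suffixAfter-offset {x} d c≡ =
    trans (cong (λ k → drop k letters) (trans (cong suc c≡) (sym (ℕ.+-suc (suc (toℕ x)) d))))
          (sym (drop-drop (suc (toℕ x)) (suc d) letters))

  blockChild⇒child : ∀ {i x b} → ChildCode i (suffixAfter x) b → ∃ λ c → Child i x c × codeAt i c ≡ b
  blockChild⇒child {i} {x} (d , (marked , unblocked) , code≡b) with drop d (suffixAfter x) in suffix
  ... | [] = contradiction marked λ ()
  ... | y ∷ ys with position-of-suffix (trans (sym (drop-drop (suc (toℕ x)) d letters)) suffix)
  ...   | c , c≡ =
    c , (offset-< d c≡ , subst (λ ys → isMarker i ys ≡ true) (sym (trans (suffixFrom-offset d c≡) suffix)) marked ,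
         free) ,
    trans (cong (code i) (suffixAfter-offset d c≡)) code≡b
    where
    free : ∀ z → x Fin.< z → z Fin.≤ c → ¬ Marked (suc i) z
    free z x<z z≤c marked-z =
      let e , z≡ = offset x<z
          e≤d = ℕ.+-cancelˡ-≤ (suc (toℕ x)) e d (subst₂ _≤_ z≡ c≡ z≤c)
          marked-e = subst (λ ys → isMarker (suc i) ys ≡ true) (suffixFrom-offset e z≡) marked-z
      in contradiction (trans (sym (unblocked e≤d)) marked-e) λ ()

  child⇒blockChild : ∀ {i x b} → (∃ λ c → Child i x c × codeAt i c ≡ b) → ChildCode i (suffixAfter x) b
  child⇒blockChild {i} {x} (c , (x<c , marked , free) , code≡b) =
    d , (subst (λ ys → isMarker i ys ≡ true) (suffixFrom-offset d c≡) marked , unblocked) ,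
    trans (cong (code i) (sym (suffixAfter-offset d c≡))) code≡b
    where
    d : ℕ
    d = proj₁ (offset x<c)
    c≡ : toℕ c ≡ suc (toℕ x) + d
    c≡ = proj₂ (offset x<c)
    unblocked : ∀ {e} → e ≤ d → isMarker (suc i) (drop e (suffixAfter x)) ≡ false
    unblocked {e} e≤d =
      let 1+x+e≤c = subst (suc (toℕ x) + e ≤_) (sym c≡) (ℕ.+-monoʳ-≤ (suc (toℕ x)) e≤d)
          z , z≡ = position (ℕ.≤-<-trans 1+x+e≤c (toℕ<n c))
      in subst (λ ys → isMarker (suc i) ys ≡ false) (suffixFrom-offset e z≡)
               (Bool.¬-not (free z (offset-< e z≡) (subst (_≤ toℕ c) (sym z≡) 1+x+e≤c)))

  ∈-childrenOf : ∀ i x {b} → b ∈ childrenOf i x ⇔ ∃ λ c → Child i x c × codeAt i c ≡ b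
  ∈-childrenOf i x = ⇔-trans (∈-children i (suffixAfter x)) (mk⇔ blockChild⇒child child⇒blockChild)

  Covers : (Pos w → Pos w → Set) → (Pos w → Pos w → Set) → Pos w → Pos w → Set
  Covers Ch Sm x y = ∀ c → Ch x c → ∃ λ d → Ch y d × Sm c d

  sat-memberF : ∀ {C E Ch Sm} → Defines₂ C Ch → Defines₂ E Sm →
                ∀ {t x u} {_ : False (t ℕ.≟ 0)} {_ : False (x ℕ.≟ 0)} {_ : False (u ℕ.≟ 0)}
                  {_ : False (u ℕ.≟ 1)} {_ : False (t ℕ.≟ u)} {_ : False (x ℕ.≟ u)} ρ →
                Sat w ρ (memberF C E t x u) ⇔ ∃ λ d → Ch (ρ x) d × Sm (ρ t) d
  sat-memberF {Ch = Ch} {Sm} C⇔ E⇔ {t} {x} {u} {t≢0} {x≢0} {u≢0} {u≢1} {t≢u} {x≢u} ρ =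
    Σ⇔ λ d → renamed C⇔ x≢0 x≢u d ×-⇔ renamed E⇔ t≢0 t≢u d
    where
    renamed : ∀ {φ R} → Defines₂ φ R → ∀ {a} → False (a ℕ.≟ 0) → False (a ℕ.≟ u) → ∀ d →
              Sat w (update w ρ u d) (φ ⟨ a ⨾ u ⟩) ⇔ R (ρ a) d
    renamed {φ} {R} φ⇔R {a} a≢0 a≢u d =
      subst₂ (λ p q → Sat w (update w ρ u d) (φ ⟨ a ⨾ u ⟩) ⇔ R p q)
             (update-other ρ u d (toWitnessFalse a≢u)) (update-same ρ u d)
             (defines-⟨⨾⟩ φ⇔R {a} {u} {a≢0} {u≢0} {u≢1} (update w ρ u d))

  defines-extensionalF : ∀ {C E Ch Sm} → Defines₂ C Ch → Defines₂ E Sm →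
                         Defines₂ (extensionalF C E) λ x y → Covers Ch Sm x y × Covers Ch Sm y x
  defines-extensionalF {C} {E} {Ch} {Sm} C⇔ E⇔ = defines₂ λ ρ →
    ⇔-trans (Π⇔ λ a → Π⇔ λ b →
               ⇔-trans (¬⊎⇔→ (((a ≟ ρ 0) ×-dec (b ≟ ρ 1)) ⊎-dec ((a ≟ ρ 1) ×-dec (b ≟ ρ 0))))
                       (→-cong-⇔ ⇔-refl (covers ρ a b)))
            (mk⇔ (λ f → f _ _ (inj₁ (refl , refl)) , f _ _ (inj₂ (refl , refl))) mutual-covers)
    where
    covers : ∀ ρ a b → Sat w (update w (update w ρ 2 a) 3 b) (∀ᶠ 4 ((¬ᶠ C ⟨ 2 ⨾ 4 ⟩) ∨ᶠ memberF C E 4 3 5))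
                       ⇔ Covers Ch Sm a b
    covers ρ a b = Π⇔ λ c →
      ⇔-trans (¬⊎⇔→ (sat? w (update w (update w (update w ρ 2 a) 3 b) 4 c) (C ⟨ 2 ⨾ 4 ⟩)))
              (→-cong-⇔ (defines-⟨⨾⟩ C⇔ {2} {4} _) (sat-memberF C⇔ E⇔ {4} {3} {5} _))
    mutual-covers : ∀ {x y} → Covers Ch Sm x y × Covers Ch Sm y x →
                    ∀ a b → (a ≡ x × b ≡ y) ⊎ (a ≡ y × b ≡ x) → Covers Ch Sm a b
    mutual-covers (xy , yx) a b (inj₁ (refl , refl)) = xy
    mutual-covers (xy , yx) a b (inj₂ (refl , refl)) = yx

  sat-childlessF : ∀ {C Ch} → Defines₂ C Ch → ∀ ρ → Sat w ρ (childlessF C) ⇔ ∃ λ x → ∀ c → ¬ Ch x c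
  sat-childlessF C⇔ ρ = Σ⇔ λ x → mk⇔
    (λ none c ch → none (c , from (defines-⟨⨾⟩ C⇔ {6} {7} _) ch))
    (λ none (c , s) → none c (to (defines-⟨⨾⟩ C⇔ {6} {7} _) s))

  sat-toggleF : ∀ {C E Ch Sm} → Defines₂ C Ch → Defines₂ E Sm →
                (member : Pos w → Pos w → Bool) →
                (∀ x t → (∃ λ d → Ch x d × Sm t d) ⇔ (member x t ≡ true)) →
                (same : Pos w → Pos w → Bool) → (∀ t y → Sm t y ⇔ (same t y ≡ true)) →
                ∀ ρ → Sat w ρ (toggleF C E) ⇔
                      (∀ x y → ∃ λ x′ → ∀ t → member x′ t ≡ member x t xor same t y)
  sat-toggleF C⇔ E⇔ member member⇔ same same⇔ ρ = Π⇔ λ x → Π⇔ λ y → Σ⇔ λ x′ → Π⇔ λ t →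
    both⇔≡ (⇔-trans (sat-memberF C⇔ E⇔ {9} {8} {10} _) (member⇔ x′ t))
           (exactlyOne⇔xor (⇔-trans (sat-memberF C⇔ E⇔ {9} {6} {11} _) (member⇔ x t))
                           (⇔-trans (defines-⟨⨾⟩ E⇔ {9} {7} _) (same⇔ t y)))

module Codes (w : Word) where
  open Definability w
  open Defines₂

  SameCode : ℕ → Pos w → Pos w → Set
  SameCode i x y = codeAt i x ≡ codeAt i y

  childBits : ∀ i → Pos w → Vec Bool (tower i)
  childBits i x = tabulate λ b → does (b ∈? childrenOf i x)

  lookup-childBits : ∀ i x b → lookup (childBits i x) b ≡ does (b ∈? childrenOf i x)
  lookup-childBits i x = lookup∘tabulate _

  covers⇒⊆ : ∀ {i x y b} → Covers (Child i) (SameCode i) x y → b ∈ childrenOf i x → b ∈ childrenOf i y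
  covers⇒⊆ {i} {x} {y} x⊑y b∈x =
    let c , x→c , c↦b = to (∈-childrenOf i x) b∈x
        d , y→d , c≈d = x⊑y c x→c
    in from (∈-childrenOf i y) (d , y→d , trans (sym c≈d) c↦b)

  ⊆⇒covers : ∀ {i x y} → (∀ {b} → b ∈ childrenOf i x → b ∈ childrenOf i y) →
             Covers (Child i) (SameCode i) x y
  ⊆⇒covers {i} {x} {y} x⊆y c x→c =
    let d , y→d , d↦c = to (∈-childrenOf i y) (x⊆y (from (∈-childrenOf i x) (c , x→c , refl)))
    in d , y→d , sym d↦c

  childBits⇒⊆ : ∀ {i x y} → childBits i x ≡ childBits i y →
                ∀ {b} → b ∈ childrenOf i x → b ∈ childrenOf i y
  childBits⇒⊆ {i} {x} {y} bits≡ {b} b∈x = from (dec⇔does (b ∈? childrenOf i y)) (begin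
    does (b ∈? childrenOf i y) ≡⟨ lookup-childBits i y b ⟨
    lookup (childBits i y) b   ≡⟨ cong (λ v → lookup v b) bits≡ ⟨
    lookup (childBits i x) b   ≡⟨ lookup-childBits i x b ⟩
    does (b ∈? childrenOf i x) ≡⟨ to (dec⇔does (b ∈? childrenOf i x)) b∈x ⟩
    true                       ∎)
    where open ≡-Reasoning

  sameCode-suc⇔ : ∀ {i x y} →
                  SameCode (suc i) x y ⇔ (Covers (Child i) (SameCode i) x y × Covers (Child i) (SameCode i) y x)
  sameCode-suc⇔ {i} {x} {y} = mk⇔
    (λ codes≡ → let bits≡ = fromBits-injective {tower i} {childBits i x} {childBits i y} codes≡
               in ⊆⇒covers (childBits⇒⊆ {i} {x} {y} bits≡) , ⊆⇒covers (childBits⇒⊆ {i} {y} {x} (sym bits≡)))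
    (λ (x⊑y , y⊑x) → cong fromBits (tabulate-cong λ b →
       does-cong (mk⇔ (covers⇒⊆ x⊑y) (covers⇒⊆ y⊑x)) (b ∈? childrenOf i x) (b ∈? childrenOf i y)))

  defines-sameCodeF : ∀ i → Defines₂ (sameCodeF i) (SameCode i)
  defines-sameCodeF zero    = defines₂ λ _ → mk⇔ (λ _ → refl) (λ _ → refl)
  defines-sameCodeF (suc i) = defines₂ λ ρ →
    ⇔-trans (sat⇔₂ (defines-extensionalF (defines-childF i) (defines-sameCodeF i)) ρ) (⇔-sym sameCode-suc⇔)

  memberBit : ∀ i → Pos w → Pos w → Bool
  memberBit i x t = does (codeAt i t ∈? childrenOf i x)

  memberBit⇔ : ∀ i x t → (∃ λ d → Child i x d × SameCode i t d) ⇔ (memberBit i x t ≡ true)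
  memberBit⇔ i x t = ⇔-trans (Σ⇔ λ d → ⇔-refl ×-⇔ mk⇔ sym sym)
                             (⇔-trans (⇔-sym (∈-childrenOf i x)) (dec⇔does (codeAt i t ∈? childrenOf i x)))

  sameBit : ∀ i → Pos w → Pos w → Bool
  sameBit i t y = does (codeAt i t ≟ codeAt i y)

  HasChildless : ℕ → Set
  HasChildless i = ∃ λ x → ∀ c → ¬ Child i x c

  HasToggles : ℕ → Set
  HasToggles i = ∀ x y → ∃ λ x′ → ∀ t → memberBit i x′ t ≡ memberBit i x t xor sameBit i t y

  Rich : ℕ → Set
  Rich k = ∀ i → i < k → HasChildless i × HasToggles i

  Rich-suc⇔ : ∀ {k} → (Rich k × HasChildless k × HasToggles k) ⇔ Rich (suc k)
  Rich-suc⇔ {k} = mk⇔ extend (λ rich → (λ i i<k → rich i (ℕ.m<n⇒m<1+n i<k)) , rich k (ℕ.n<1+n k))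
    where
    extend : Rich k × HasChildless k × HasToggles k → Rich (suc k)
    extend (rich , top) i (s≤s i≤k) with ℕ.m≤n⇒m<n∨m≡n i≤k
    ... | inj₁ i<k  = rich i i<k
    ... | inj₂ refl = top

  sat-towerF : ∀ k ρ → Sat w ρ (towerF k) ⇔ Rich k
  sat-towerF zero    ρ = mk⇔ (λ _ _ ()) (λ _ _ → refl)
  sat-towerF (suc k) ρ = ⇔-trans
    (sat-towerF k ρ ×-⇔ (sat-childlessF (defines-childF k) ρ ×-⇔
      sat-toggleF (defines-childF k) (defines-sameCodeF k) (memberBit k) (memberBit⇔ k)
                  (sameBit k) (λ t y → dec⇔does (codeAt k t ≟ codeAt k y)) ρ))
    Rich-suc⇔

  childless⇒childBits : ∀ {i x} → (∀ c → ¬ Child i x c) → childBits i x ≡ Vec.replicate (tower i) false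
  childless⇒childBits {i} {x} none =
    trans (tabulate-cong λ b → trans (dec-false (b ∈? childrenOf i x) (no-child b)) (sym (lookup-replicate b false)))
          (tabulate∘lookup _)
    where
    no-child : ∀ b → ¬ b ∈ childrenOf i x
    no-child b b∈ = let c , x→c , _ = to (∈-childrenOf i x) b∈ in none c x→c

  toggled⇒childBits : ∀ {i x y x′} → (∀ b → ∃ λ t → codeAt i t ≡ b) →
                      (∀ t → memberBit i x′ t ≡ memberBit i x t xor sameBit i t y) →
                      childBits i x′ ≡ toggle (childBits i x) (codeAt i y)
  toggled⇒childBits {i} {x} {y} {x′} realized flips = tabulate-cong flipped
    where
    flipped : ∀ b → does (b ∈? childrenOf i x′) ≡ lookup (childBits i x) b xor does (b ≟ codeAt i y)
    flipped b with t , refl ← realized b =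
      trans (flips t) (cong (_xor sameBit i t y) (sym (lookup-childBits i x (codeAt i t))))

  childBits⇒toggled : ∀ {i x y x′} → childBits i x′ ≡ toggle (childBits i x) (codeAt i y) →
                      ∀ t → memberBit i x′ t ≡ memberBit i x t xor sameBit i t y
  childBits⇒toggled {i} {x} {y} {x′} bits≡ t = begin
    memberBit i x′ t
      ≡⟨ lookup-childBits i x′ (codeAt i t) ⟨
    lookup (childBits i x′) (codeAt i t)
      ≡⟨ cong (λ v → lookup v (codeAt i t)) bits≡ ⟩
    lookup (toggle (childBits i x) (codeAt i y)) (codeAt i t)
      ≡⟨ lookup∘tabulate _ (codeAt i t) ⟩
    lookup (childBits i x) (codeAt i t) xor sameBit i t y
      ≡⟨ cong (_xor sameBit i t y) (lookup-childBits i x (codeAt i t)) ⟩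
    memberBit i x t xor sameBit i t y ∎
    where open ≡-Reasoning

  codes-realized : ∀ {k} → Rich k → ∀ {i} → i ≤ k → ∀ b → ∃ λ x → codeAt i x ≡ b
  codes-realized rich {zero}  _   Fin.zero = Fin.zero , refl
  codes-realized rich {suc i} i<k b =
    let v , v↦b    = fromBits-surjective b
        x , bits≡v = toggle-generates (λ v → ∃ λ x → childBits i x ≡ v) childless toggled v
    in x , trans (cong fromBits bits≡v) v↦b
    where
    realized : ∀ b → ∃ λ x → codeAt i x ≡ b
    realized = codes-realized rich (ℕ.<⇒≤ i<k)
    childless : ∃ λ x → childBits i x ≡ Vec.replicate (tower i) false
    childless = let x , none = proj₁ (rich i i<k) in x , childless⇒childBits none
    toggled : ∀ v a → (∃ λ x → childBits i x ≡ v) → ∃ λ x′ → childBits i x′ ≡ toggle v a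
    toggled v a (x , refl) =
      let y , y↦a    = realized a
          x′ , flips = proj₂ (rich i i<k) x y
      in x′ , trans (toggled⇒childBits {i} {x} {y} {x′} realized flips) (cong (toggle (childBits i x)) y↦a)

  tower≤length : ∀ {k} → Rich k → tower k ≤ List⁺.length w
  tower≤length {k} rich = injective⇒≤ {f = realizer} λ {a} {b} same →
    trans (sym (realizes a)) (trans (cong (codeAt k) same) (realizes b))
    where
    realizer : Fin (tower k) → Pos w
    realizer b = proj₁ (codes-realized rich ℕ.≤-refl b)
    realizes : ∀ b → codeAt k (realizer b) ≡ b
    realizes b = proj₂ (codes-realized rich ℕ.≤-refl b)

  ⊨-towerF⇔ : ∀ k → w ⊨ towerF k ⇔ Rich k
  ⊨-towerF⇔ k = mk⇔ (λ w⊨ → to (sat-towerF k ρ₀) (w⊨ ρ₀)) (λ rich ρ → from (sat-towerF k ρ) rich)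
    where
    ρ₀ : Assign w
    ρ₀ _ = Fin.zero

  ⊨-towerF? : ∀ k → Dec (w ⊨ towerF k)
  ⊨-towerF? k =
    map′ (λ s → from (⊨-towerF⇔ k) (to (sat-towerF k ρ₀) s)) (λ w⊨ → w⊨ ρ₀) (sat? w ρ₀ (towerF k))
    where
    ρ₀ : Assign w
    ρ₀ _ = Fin.zero

markers : List ℕ → List Letter
markers []       = []
markers (m ∷ ms) = r ∷ replicate m l ++ markers ms

markers-++ : ∀ ms ns → markers (ms ++ ns) ≡ markers ms ++ markers ns
markers-++ []       ns = refl
markers-++ (m ∷ ms) ns = cong (r ∷_) (trans (cong (replicate m l ++_) (markers-++ ms ns))
                                            (sym (++-assoc (replicate m l) (markers ms) (markers ns))))

children-ls : ∀ i m ys → children i (replicate m l ++ ys) ≡ children i ys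
children-ls i zero    ys = refl
children-ls i (suc m) ys = children-ls i m ys

code-ls : ∀ i m ys → code i (replicate m l ++ ys) ≡ code i ys
code-ls zero    m ys = refl
code-ls (suc i) m ys = cong (λ cs → fromBits (tabulate λ b → does (b ∈? cs))) (children-ls i m ys)

startsWithLs-≤ : ∀ {j m} ys → j ≤ m → startsWithLs j (replicate m l ++ ys) ≡ true
startsWithLs-≤ ys z≤n       = refl
startsWithLs-≤ ys (s≤s j≤m) = startsWithLs-≤ ys j≤m

startsWithLs-> : ∀ {j m} ms → m < j → startsWithLs j (replicate m l ++ markers ms) ≡ false
startsWithLs-> {m = zero}  []      (s≤s _)   = refl
startsWithLs-> {m = zero}  (_ ∷ _) (s≤s _)   = refl
startsWithLs-> {m = suc m} ms      (s≤s m<j) = startsWithLs-> ms m<j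

children-marker-higher : ∀ {i m} ms → i < m → children i (markers (m ∷ ms)) ≡ []
children-marker-higher ms i<m rewrite startsWithLs-≤ (markers ms) i<m = refl

children-marker-same : ∀ i ms →
                       children i (markers (i ∷ ms)) ≡ code i (replicate i l ++ markers ms) ∷ children i (markers ms)
children-marker-same i ms
  rewrite startsWithLs-> ms (ℕ.n<1+n i) | startsWithLs-≤ (markers ms) (ℕ.≤-refl {i}) =
  cong (code i (replicate i l ++ markers ms) ∷_) (children-ls i i _)

children-marker-lower : ∀ {i m} ms → m < i → children i (markers (m ∷ ms)) ≡ children i (markers ms)
children-marker-lower {i} {m} ms m<i
  rewrite startsWithLs-> ms (ℕ.m<n⇒m<1+n m<i) | startsWithLs-> ms m<i = children-ls i m (markers ms)

children-lower : ∀ {i} ms ns → All (_< i) ms → children i (markers (ms ++ ns)) ≡ children i (markers ns)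
children-lower []       ns All.[]           = refl
children-lower (m ∷ ms) ns (m<i All.∷ ms<i) = trans (children-marker-lower (ms ++ ns) m<i) (children-lower ms ns ms<i)

bitsOf : ∀ {t} → Fin (2 ℕ.^ t) → Vec Bool t
bitsOf S = proj₁ (fromBits-surjective S)

encode     : ∀ j → Fin (tower j) → List ℕ
encodeBody : ∀ j → Fin (tower j) → List ℕ
encodeAll  : ∀ j → List (Fin (tower j)) → List ℕ

encode j S = j ∷ encodeBody j S

encodeBody zero    _ = []
encodeBody (suc j) S = encodeAll j (members (bitsOf {tower j} S))

encodeAll j []       = []
encodeAll j (a ∷ as) = encode j a ++ encodeAll j as

encodeBody-< : ∀ j S → All (_< j) (encodeBody j S)
encodeAll-≤  : ∀ j as → All (_< suc j) (encodeAll j as)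

encodeBody-< zero    _ = All.[]
encodeBody-< (suc j) S = encodeAll-≤ j (members (bitsOf {tower j} S))

encodeAll-≤ j []       = All.[]
encodeAll-≤ j (a ∷ as) = ++⁺ (ℕ.≤-refl All.∷ All.map ℕ.m<n⇒m<1+n (encodeBody-< j a)) (encodeAll-≤ j as)

StartsAtLeast : ℕ → List ℕ → Set
StartsAtLeast j []      = ⊤
StartsAtLeast j (m ∷ _) = j ≤ m

encodeAll-starts : ∀ j as post → StartsAtLeast (suc j) post → StartsAtLeast j (encodeAll j as ++ post)
encodeAll-starts j []      []      _   = _
encodeAll-starts j []      (_ ∷ _) j<m = ℕ.<⇒≤ j<m
encodeAll-starts j (_ ∷ _) _       _   = ℕ.≤-refl

code-encode        : ∀ j S post → StartsAtLeast j post →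
                     code j (replicate j l ++ markers (encodeBody j S ++ post)) ≡ S
children-encodeAll : ∀ j as post → StartsAtLeast (suc j) post → children j (markers (encodeAll j as ++ post)) ≡ as

code-encode zero    Fin.zero post _ = refl
code-encode (suc j) S post starts = begin
  code (suc j) (replicate (suc j) l ++ markers (encodeAll j as ++ post))
    ≡⟨ code-ls (suc j) (suc j) _ ⟩
  fromBits (tabulate λ b → does (b ∈? children j (markers (encodeAll j as ++ post))))
    ≡⟨ cong (λ cs → fromBits (tabulate λ b → does (b ∈? cs))) (children-encodeAll j as post starts) ⟩
  fromBits (tabulate λ b → does (b ∈? as))
    ≡⟨ cong fromBits (trans (tabulate-cong λ b → does-≡ (∈-members v) (b ∈? as)) (tabulate∘lookup v)) ⟩
  fromBits v
    ≡⟨ proj₂ (fromBits-surjective {tower j} S) ⟩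
  S ∎
  where
  open ≡-Reasoning
  v : Vec Bool (tower j)
  v = bitsOf {tower j} S
  as : List (Fin (tower j))
  as = members v

children-encodeAll j []       []         _   = refl
children-encodeAll j []       (m ∷ post) j<m = children-marker-higher post j<m
children-encodeAll j (a ∷ as) post starts = begin
  children j (markers (j ∷ (encodeBody j a ++ encodeAll j as) ++ post))
    ≡⟨ cong (λ ms → children j (markers (j ∷ ms))) (++-assoc (encodeBody j a) (encodeAll j as) post) ⟩
  children j (markers (j ∷ encodeBody j a ++ rest))
    ≡⟨ children-marker-same j (encodeBody j a ++ rest) ⟩
  code j (replicate j l ++ markers (encodeBody j a ++ rest)) ∷ children j (markers (encodeBody j a ++ rest))
    ≡⟨ cong₂ _∷_ (code-encode j a rest (encodeAll-starts j as post starts))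
                 (trans (children-lower (encodeBody j a) rest (encodeBody-< j a)) (children-encodeAll j as post starts)) ⟩
  a ∷ as ∎
  where
  open ≡-Reasoning
  rest : List ℕ
  rest = encodeAll j as ++ post

-- The model lists every code of level ≤ k, each followed by a separator marker of level k, which ends the
-- child lists of the positions before it.
block : ℕ → ∀ j → List (Fin (tower j)) → List ℕ
block k j []       = []
block k j (S ∷ Ss) = encode j S ++ k ∷ block k j Ss

layers : ℕ → ℕ → List ℕ
layers k zero    = block k zero (allFin (tower zero))
layers k (suc j) = block k (suc j) (allFin (tower (suc j))) ++ layers k j

Occurs : ℕ → List ℕ → ∀ j → Fin (tower j) → Set
Occurs k ms j S = ∃ λ A → ∃ λ B → ms ≡ A ++ encode j S ++ k ∷ B

occurs-++ˡ : ∀ {k ms j S} ns → Occurs k ms j S → Occurs k (ms ++ ns) j S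
occurs-++ˡ {k} {j = j} {S} ns (A , B , ms≡) =
  A , B ++ ns , trans (cong (_++ ns) ms≡)
                      (trans (++-assoc A _ ns) (cong (A ++_) (++-assoc (encode j S) (k ∷ B) ns)))

occurs-++ʳ : ∀ {k ns j S} ms → Occurs k ns j S → Occurs k (ms ++ ns) j S
occurs-++ʳ ms (A , B , ns≡) = ms ++ A , B , trans (cong (ms ++_) ns≡) (sym (++-assoc ms A _))

block-occurs : ∀ k j {S Ss} → S ∈ Ss → Occurs k (block k j Ss) j S
block-occurs k j {Ss = S ∷ Ss} (here refl) = [] , block k j Ss , refl
block-occurs k j {Ss = S′ ∷ Ss} (there S∈) =
  let A , B , Ss≡ = block-occurs k j S∈
  in encode j S′ ++ k ∷ A , B ,
     trans (cong (λ ms → encode j S′ ++ k ∷ ms) Ss≡) (sym (++-assoc (encode j S′) (k ∷ A) _))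

layers-occurs : ∀ k {j₀ j} (S : Fin (tower j)) → j ≤ j₀ → Occurs k (layers k j₀) j S
layers-occurs k {zero}   S z≤n = block-occurs k zero (∈-allFin S)
layers-occurs k {suc j₀} S j≤1+j₀ with ℕ.m≤n⇒m<n∨m≡n j≤1+j₀
... | inj₂ refl       = occurs-++ˡ (layers k j₀) (block-occurs k (suc j₀) (∈-allFin S))
... | inj₁ (s≤s j≤j₀) = occurs-++ʳ (block k (suc j₀) (allFin _)) (layers-occurs k S j≤j₀)

modelWord : ℕ → Word
modelWord k = r List⁺.∷ markers (layers k k)

module Model (k : ℕ) where
  open Definability (modelWord k)
  open Codes (modelWord k)

  marker-suffix : ∀ {j} {S : Fin (tower j)} A B → layers k k ≡ A ++ encode j S ++ k ∷ B →
                  drop (length (markers (0 ∷ A))) letters ≡ r ∷ replicate j l ++ markers (encodeBody j S ++ k ∷ B)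
  marker-suffix A B layers≡ =
    trans (cong (drop (length (markers (0 ∷ A))))
                (trans (cong (λ ms → markers (0 ∷ ms)) layers≡) (markers-++ (0 ∷ A) _)))
          (drop-length-++ (markers (0 ∷ A)))

  realized : ∀ {j} → j ≤ k → ∀ S → ∃ λ x → codeAt j x ≡ S
  realized {j} j≤k S with A , B , layers≡ ← layers-occurs k S j≤k
    with x , x≡ ← position-of-suffix {length (markers (0 ∷ A))} (marker-suffix A B layers≡) =
    let from-x = trans (cong (λ n → drop n letters) x≡) (marker-suffix A B layers≡)
    in x , trans (cong (code j) (∷-injectiveʳ (trans (sym (suffixFrom-∷ x)) from-x))) (code-encode j S (k ∷ B) j≤k)

  childless : ∀ i → HasChildless i
  childless i = Fin.fromℕ _ , λ c (last<c , _) → ℕ.<⇒≱ last<c (≤fromℕ c)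

  toggles : ∀ {i} → i < k → HasToggles i
  toggles {i} i<k x y =
    let x′ , x′↦v = realized i<k (fromBits (toggle (childBits i x) (codeAt i y)))
    in x′ , childBits⇒toggled {i} {x} {y} {x′} (fromBits-injective {tower i} x′↦v)

  modelWord-⊨ : modelWord k ⊨ towerF k
  modelWord-⊨ = from (⊨-towerF⇔ k) λ i i<k → childless i , toggles i<k

μ-towerF : ∀ k → ∃ λ m → IsMu (towerF k) m × tower k ≤ m
μ-towerF k =
  let m , isMu , w , w⊨ , w≡m = μ-of-satisfiable (λ w → Codes.⊨-towerF? w k) (Model.modelWord-⊨ k)
  in m , isMu , subst (tower k ≤_) w≡m (Codes.tower≤length w (to (Codes.⊨-towerF⇔ w k) w⊨))

corollary6 : Σ ℕ λ c → (1 ≤ c) × ((N : ℕ) → Σ ℕ λ n → (N ≤ n) ×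
               ((k : ℕ) → IsCeilCbrt n c k → (L : ℕ) → IsLS n L → tower k ≤ L))
corollary6 = 409 , s≤s z≤n , λ N → 409 * suc N ^ 3 , N≤n N , bound N
  where
  N≤n : ∀ N → N ≤ 409 * suc N ^ 3
  N≤n N = ℕ.≤-trans (ℕ.n≤1+n N) (ℕ.≤-trans (ℕ.m≤m*n (suc N) (suc N ^ 2)) (ℕ.m≤n*m _ 409))
  bound : ∀ N k → IsCeilCbrt (409 * suc N ^ 3) 409 k → ∀ L → IsLS (409 * suc N ^ 3) L → tower k ≤ L
  bound N k (_ , below) L (_ , maximal) =
    let m , isMu , tower≤m = μ-towerF (suc N)
    in begin
      tower k       ≤⟨ tower-mono (ℕ.≮⇒≥ λ 1+N<k → ℕ.<-irrefl refl (below (suc N) 1+N<k)) ⟩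
      tower (suc N) ≤⟨ tower≤m ⟩
      m             ≤⟨ maximal (towerF (suc N)) (sentence (scoped-towerF (suc N))) (sz-towerF N) m isMu ⟩
      L             ∎
    where open ℕ.≤-Reasoning
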